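{- Let $t,t'$ be resource $\lambda\mu$-terms and $\mathcal T$ a sum. If $t\to_{\rho^r}t'+\mathcal T$, then $\mathrm{ms}(t)\ge\mathrm{ms}(t')$. Moreover, equality can hold: for distinct names $\beta\ne\eta$, one has $\mu\gamma.{}_\alpha|\mu\beta.{}_\eta|x||\to_{\rho^r}\mu\gamma.{}_\eta|x|$ and $\mathrm{ms}(\mu\gamma.{}_\alpha|\mu\beta.{}_\eta|x||)=1=\mathrm{ms}(\mu\gamma.{}_\eta|x|)$, where $1$ is the empty multiset.
   Context: Resource $\lambda\mu$-terms (over disjoint countable sets of variables and names) are generated by $t::=x\mid\lambda x.t\mid t[t_1,\dots,t_n]\mid\mu\alpha.{}_\beta|t|$, with bags finite multisets. Sums are finite sets with idempotent $+$. The reduction $\to_{\rho^r}$ is the closure under single-hole resource contexts of $\mu\gamma.{}_\alpha|\mu\beta.{}_\eta|s||\to\mu\gamma.({}_\eta|s|)\{\alpha/\beta\}$, where $\{\alpha/\beta\}$ renames all free occurrences of the name $\beta$ (including $\eta$ if $\eta=\beta$) into $\alpha$. Measure. - $\deg_\mu(t)$ is the number of $\mu$-abstractions of $t$. - For an occurrence $b$ of a bag in $t$, $d_t(b)$ is the number of named subterms ${}_\beta|s|$ of $t$ containing $b$. - $\mathrm{ms}(t):=[\deg_\mu(t)-d_t(b)\mid b\text{ occurrence of a bag in }t]$, a finite multiset of naturals, ordered by the multiset order induced by $<$ on $\mathbb N$ (with $\ge$ meaning $>$ or $=$). -}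

module Defs where

open import Data.Nat using (ℕ; zero; suc; _<_; _∸_; _+_)
open import Data.List using (List; []; _∷_; _++_; map; concat)
open import Data.List.Relation.Unary.All using (All)
open import Data.List.Relation.Unary.Any using (Any)
open import Data.List.Relation.Binary.Permutation.Propositional using (_↭_)
open import Data.List.Membership.Propositional using (_∈_)
open import Data.Product using (Σ; ∃; _×_)
open import Data.Sum using (_⊎_)
open import Relation.Binary.PropositionalEquality using (_≡_; _≢_)

-- Resource λμ-terms, with de Bruijn indices for variables and names.
--   var x      : the variable x
--   lam t      : λx.t           (binds variable index 0)
--   app t bs   : t[t₁,…,tₙ]     (the bag is a list; order is irrelevant)
--   mu β t     : μα.[β]t        (binds name index 0 in β and t)

data Term : Set where
  var : ℕ → Term
  lam : Term → Term
  app : Term → List Term → Term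
  mu  : ℕ → Term → Term

Bag : Set
Bag = List Term

-- Sums: finite sets of terms, represented by lists up to set equality.
Sum : Set
Sum = List Term

_≈ₛ_ : Sum → Sum → Set
S ≈ₛ S' = ∀ u → (u ∈ S → u ∈ S') × (u ∈ S' → u ∈ S)

ext : (ℕ → ℕ) → ℕ → ℕ
ext ρ zero    = zero
ext ρ (suc k) = suc (ρ k)

mutual
  ren : (ℕ → ℕ) → Term → Term
  ren ρ (var x)    = var x
  ren ρ (lam t)    = lam (ren ρ t)
  ren ρ (app t bs) = app (ren ρ t) (renBag ρ bs)
  ren ρ (mu β t)   = mu (ext ρ β) (ren (ext ρ) t)

  renBag : (ℕ → ℕ) → Bag → Bag
  renBag ρ []       = []
  renBag ρ (t ∷ bs) = ren ρ t ∷ renBag ρ bs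

-- {α/β} where β is the innermost bound name (index 0): 0 ↦ α, k+1 ↦ k.
σ : ℕ → ℕ → ℕ
σ α zero    = α
σ α (suc k) = k

-- The reduction →ρʳ: root step μγ.[α]μβ.[η]s → μγ.([η]s){α/β},
-- closed under single-hole resource contexts.

data _⟶ρ₁_ : Term → Term → Set where
  root : ∀ α η s → mu α (mu η s) ⟶ρ₁ mu (σ α η) (ren (σ α) s)
  lamC : ∀ {t u} → t ⟶ρ₁ u → lam t ⟶ρ₁ lam u
  appL : ∀ {t u bs} → t ⟶ρ₁ u → app t bs ⟶ρ₁ app u bs
  appR : ∀ {s t u} bs cs → t ⟶ρ₁ u → app s (bs ++ t ∷ cs) ⟶ρ₁ app s (bs ++ u ∷ cs)
  muC  : ∀ {β t u} → t ⟶ρ₁ u → mu β t ⟶ρ₁ mu β u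

-- Reduction from a term to a sum: the context closure of a ρʳ-step
-- produces a single term, so the reduct is the singleton sum.
_⟶ρ_ : Term → Sum → Set
t ⟶ρ S = Σ Term (λ u → (t ⟶ρ₁ u) × (S ≈ₛ (u ∷ [])))

mutual
  degμ : Term → ℕ
  degμ (var x)    = 0
  degμ (lam t)    = degμ t
  degμ (app t bs) = degμ t + degμBag bs
  degμ (mu β t)   = suc (degμ t)

  degμBag : Bag → ℕ
  degμBag []       = 0
  degμBag (t ∷ bs) = degμ t + degμBag bs

-- For each bag occurrence b of t, the number d_t(b) of named subterms
-- [β]s of t containing b (the named subterm of μα.[β]s contains exactly
-- the bag occurrences of s).
mutual
  bagDepths : Term → List ℕ
  bagDepths (var x)    = []
  bagDepths (lam t)    = bagDepths t
  bagDepths (app t bs) = 0 ∷ (bagDepths t ++ bagDepthsBag bs)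
  bagDepths (mu β t)   = map suc (bagDepths t)

  bagDepthsBag : Bag → List ℕ
  bagDepthsBag []       = []
  bagDepthsBag (t ∷ bs) = bagDepths t ++ bagDepthsBag bs

-- ms(t) = [ deg_μ(t) - d_t(b) | b bag occurrence of t ]  (d_t(b) ≤ deg_μ(t))
ms : Term → List ℕ
ms t = map (λ d → degμ t ∸ d) (bagDepths t)

-- Multiset order on finite multisets of naturals (lists up to ↭),
-- Dershowitz–Manna: M > N iff N is obtained from M by replacing a
-- nonempty sub-multiset X by a multiset Y of elements each smaller than
-- some element of X.

_>ₘ_ : List ℕ → List ℕ → Set
M >ₘ N = ∃ λ Z → ∃ λ X → ∃ λ Y →
  (X ≢ []) × (M ↭ (Z ++ X)) × (N ↭ (Z ++ Y)) × All (λ y → Any (y <_) X) Y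

_≥ₘ_ : List ℕ → List ℕ → Set
M ≥ₘ N = (M >ₘ N) ⊎ (M ↭ N)

-- Proof idea: a ρʳ-step destroys exactly one μ-abstraction, so deg_μ drops by one,
-- while every bag occurrence survives (renaming does not touch bags) and loses at
-- most one enclosing named subterm. Hence each entry deg_μ − d of the measure
-- weakly decreases, and a pointwise decrease is a decrease in the multiset order.
module Submission where

open import Defs
open import Data.Nat using (ℕ; zero; suc; pred; _+_; _∸_; _≤_; _≥_; z≤n; s≤s)
open import Data.Nat.Properties using (+-assoc; +-suc; n≤1+n; ≤-refl; m≤n⇒m<n∨m≡n; ∸-monoʳ-≤)
open import Data.List using (List; []; _∷_; _++_; map)
open import Data.List.Properties using (++-assoc)
open import Data.List.Relation.Unary.All as All using ([]; _∷_)
open import Data.List.Relation.Unary.Any using (here; there)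
open import Data.List.Relation.Binary.Pointwise as Pointwise using (Pointwise; []; _∷_)
open import Data.List.Relation.Binary.Permutation.Propositional using (prep; ↭-refl; ↭-sym; ↭-trans)
open import Data.List.Relation.Binary.Permutation.Propositional.Properties using (shift; ∷↭∷ʳ)
open import Data.Product using (_×_; _,_; proj₁)
open import Data.Sum using (inj₁; inj₂)
open import Relation.Binary.PropositionalEquality using (_≡_; _≢_; refl; sym; trans; cong; cong₂)
open import Function using (_∘_)

mutual
  degμ-ren : ∀ ρ t → degμ (ren ρ t) ≡ degμ t
  degμ-ren ρ (var x)    = refl
  degμ-ren ρ (lam t)    = degμ-ren ρ t
  degμ-ren ρ (app t bs) = cong₂ _+_ (degμ-ren ρ t) (degμBag-renBag ρ bs)
  degμ-ren ρ (mu β t)   = cong suc (degμ-ren (ext ρ) t)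

  degμBag-renBag : ∀ ρ bs → degμBag (renBag ρ bs) ≡ degμBag bs
  degμBag-renBag ρ []       = refl
  degμBag-renBag ρ (t ∷ bs) = cong₂ _+_ (degμ-ren ρ t) (degμBag-renBag ρ bs)

mutual
  bagDepths-ren : ∀ ρ t → bagDepths (ren ρ t) ≡ bagDepths t
  bagDepths-ren ρ (var x)    = refl
  bagDepths-ren ρ (lam t)    = bagDepths-ren ρ t
  bagDepths-ren ρ (app t bs) = cong (0 ∷_) (cong₂ _++_ (bagDepths-ren ρ t) (bagDepthsBag-renBag ρ bs))
  bagDepths-ren ρ (mu β t)   = cong (map suc) (bagDepths-ren (ext ρ) t)

  bagDepthsBag-renBag : ∀ ρ bs → bagDepthsBag (renBag ρ bs) ≡ bagDepthsBag bs
  bagDepthsBag-renBag ρ []       = refl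
  bagDepthsBag-renBag ρ (t ∷ bs) = cong₂ _++_ (bagDepths-ren ρ t) (bagDepthsBag-renBag ρ bs)

degμBag-++ : ∀ bs cs → degμBag (bs ++ cs) ≡ degμBag bs + degμBag cs
degμBag-++ []       cs = refl
degμBag-++ (t ∷ bs) cs = trans (cong (degμ t +_) (degμBag-++ bs cs)) (sym (+-assoc (degμ t) _ _))

bagDepthsBag-++ : ∀ bs cs → bagDepthsBag (bs ++ cs) ≡ bagDepthsBag bs ++ bagDepthsBag cs
bagDepthsBag-++ []       cs = refl
bagDepthsBag-++ (t ∷ bs) cs =
  trans (cong (bagDepths t ++_) (bagDepthsBag-++ bs cs)) (sym (++-assoc (bagDepths t) _ _))

⟶ρ₁-degμ : ∀ {t u} → t ⟶ρ₁ u → degμ t ≡ suc (degμ u)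
⟶ρ₁-degμ (root α η s) = cong (suc ∘ suc) (sym (degμ-ren (σ α) s))
⟶ρ₁-degμ (lamC r)     = ⟶ρ₁-degμ r
⟶ρ₁-degμ (appL {bs = bs} r) = cong (_+ degμBag bs) (⟶ρ₁-degμ r)
⟶ρ₁-degμ (appR {s} {t} {u} bs cs r)
  rewrite degμBag-++ bs (t ∷ cs) | degμBag-++ bs (u ∷ cs) | ⟶ρ₁-degμ r =
  trans (cong (degμ s +_) (+-suc (degμBag bs) _)) (+-suc (degμ s) _)
⟶ρ₁-degμ (muC r) = cong suc (⟶ρ₁-degμ r)

AtMostOneShallower : List ℕ → List ℕ → Set
AtMostOneShallower = Pointwise (λ d d' → d ≤ suc d')

AtMostOneShallower-refl : ∀ ds → AtMostOneShallower ds ds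
AtMostOneShallower-refl ds = Pointwise.refl (n≤1+n _)

⟶ρ₁-bagDepths : ∀ {t u} → t ⟶ρ₁ u → AtMostOneShallower (bagDepths t) (bagDepths u)
⟶ρ₁-bagDepths (root α η s) rewrite bagDepths-ren (σ α) s = unshift (bagDepths s)
  where
  unshift : ∀ ds → AtMostOneShallower (map suc (map suc ds)) (map suc ds)
  unshift []       = []
  unshift (d ∷ ds) = ≤-refl ∷ unshift ds
⟶ρ₁-bagDepths (lamC r) = ⟶ρ₁-bagDepths r
⟶ρ₁-bagDepths (appL {bs = bs} r) =
  z≤n ∷ Pointwise.++⁺ (⟶ρ₁-bagDepths r) (AtMostOneShallower-refl (bagDepthsBag bs))
⟶ρ₁-bagDepths (appR {s} {t} {u} bs cs r)
  rewrite bagDepthsBag-++ bs (t ∷ cs) | bagDepthsBag-++ bs (u ∷ cs) =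
  z≤n ∷ Pointwise.++⁺ (AtMostOneShallower-refl (bagDepths s))
          (Pointwise.++⁺ (AtMostOneShallower-refl (bagDepthsBag bs))
            (Pointwise.++⁺ (⟶ρ₁-bagDepths r) (AtMostOneShallower-refl (bagDepthsBag cs))))
⟶ρ₁-bagDepths (muC r) = Pointwise.map⁺ suc suc (Pointwise.map s≤s (⟶ρ₁-bagDepths r))

⟶ρ₁-ms : ∀ {t u} → t ⟶ρ₁ u → Pointwise _≥_ (ms t) (ms u)
-- With m = degμ u, a depth d ≤ suc d' gives suc m ∸ d ≥ suc m ∸ suc d' = m ∸ d'.
⟶ρ₁-ms {t} {u} r rewrite ⟶ρ₁-degμ r =
  Pointwise.map⁺ (suc (degμ u) ∸_) (degμ u ∸_) (Pointwise.map (∸-monoʳ-≤ (suc (degμ u))) (⟶ρ₁-bagDepths r))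

∷-≥ₘ : ∀ {a b M N} → a ≥ b → M ≥ₘ N → (a ∷ M) ≥ₘ (b ∷ N)
∷-≥ₘ {a} {b} {M} a≥b M≥N with m≤n⇒m<n∨m≡n a≥b | M≥N
... | inj₂ refl | inj₂ M↭N = inj₂ (prep a M↭N)
... | inj₂ refl | inj₁ (Z , X , Y , X≢[] , M↭Z++X , N↭Z++Y , Y<X) =
  inj₁ (a ∷ Z , X , Y , X≢[] , prep a M↭Z++X , prep a N↭Z++Y , Y<X)
... | inj₁ b<a | inj₂ M↭N =
  inj₁ (M , a ∷ [] , b ∷ [] , (λ ()) , ∷↭∷ʳ a M , ↭-trans (prep b (↭-sym M↭N)) (∷↭∷ʳ b M) , here b<a ∷ [])
... | inj₁ b<a | inj₁ (Z , X , Y , X≢[] , M↭Z++X , N↭Z++Y , Y<X) =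
  inj₁ (Z , a ∷ X , b ∷ Y , (λ ()) ,
        ↭-trans (prep a M↭Z++X) (↭-sym (shift a Z X)) ,
        ↭-trans (prep b N↭Z++Y) (↭-sym (shift b Z Y)) ,
        here b<a ∷ All.map there Y<X)

Pointwise-≥⇒≥ₘ : ∀ {M N} → Pointwise _≥_ M N → M ≥ₘ N
Pointwise-≥⇒≥ₘ []          = inj₂ ↭-refl
Pointwise-≥⇒≥ₘ (a≥b ∷ M≥N) = ∷-≥ₘ a≥b (Pointwise-≥⇒≥ₘ M≥N)

proposition2p11 :
    (∀ (t t' : Term) (T : Sum) → t ⟶ρ (t' ∷ T) → ms t ≥ₘ ms t')
    × (∀ (α η x : ℕ) → η ≢ 0 →
         (mu α (mu η (var x)) ⟶ρ (mu (pred η) (var x) ∷ []))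
         × (ms (mu α (mu η (var x))) ≡ [])
         × (ms (mu (pred η) (var x)) ≡ []))
proposition2p11 = measure-nonincreasing , equality-example
  where
  measure-nonincreasing : ∀ t t' T → t ⟶ρ (t' ∷ T) → ms t ≥ₘ ms t'
  measure-nonincreasing t t' T (u , t⟶u , t'∷T≈u) with proj₁ (t'∷T≈u t') (here refl)
  ... | here refl = Pointwise-≥⇒≥ₘ (⟶ρ₁-ms t⟶u)

  equality-example : ∀ α η x → η ≢ 0 →
    (mu α (mu η (var x)) ⟶ρ (mu (pred η) (var x) ∷ []))
    × (ms (mu α (mu η (var x))) ≡ []) × (ms (mu (pred η) (var x)) ≡ [])
  -- η ≢ 0 is β ≠ η in de Bruijn form (β is name 0); renaming then yields pred η.
  equality-example α zero    x η≢0 with () ← η≢0 refl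
  equality-example α (suc η) x _ =
    (mu η (var x) , root α (suc η) (var x) , λ _ → (λ u∈ → u∈) , (λ u∈ → u∈)) , refl , refl
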